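{- Let $d\ge 1$, $n\ge 1$ and $h\ge 0$ be integers. The number of $d$-ary multi-edge trees of height $h$ with $n$ vertices equals the number of $d$-ary trees of height $h$ with $n$ vertices.
   Context: A plane (ordered) rooted multi-edge tree is a rooted plane tree in which each non-root vertex is joined to its parent by a positive number of parallel edges; children of a vertex are linearly ordered. If a vertex has children joined to it by $k_1,\dots,k_r$ edges, its out-degree is $k_1+\dots+k_r$. A $d$-ary multi-edge tree is such a tree in which every vertex has out-degree at most $d$. A $d$-ary tree (pruned $d$-ary tree) is a rooted tree in which each vertex has $d$ distinct positions at which a child may be attached, each position holding at most one child. The height of a tree is the maximum distance (number of parent-child steps) of a vertex from the root. -}

module Defs where

open import Data.Nat using (ℕ; zero; suc; _+_; _⊔_; _≤ᵇ_)
open import Data.Bool using (Bool; true; false; _∧_)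
open import Data.List using (List; []; _∷_)
open import Data.Vec using (Vec; []; _∷_)
open import Data.Maybe using (Maybe; just; nothing)
open import Data.Product using (_×_; _,_)

-- Plane rooted multi-edge trees.
-- A vertex is given by the ordered list of its children; each child is
-- paired with k, meaning it is joined to its parent by (suc k) ≥ 1
-- parallel edges.

data MTree : Set where
  mnode : List (ℕ × MTree) → MTree

outdeg : MTree → ℕ
outdeg (mnode cs) = go cs
  where
  go : List (ℕ × MTree) → ℕ
  go [] = 0
  go ((k , _) ∷ cs) = suc k + go cs

mutual
  msize : MTree → ℕ
  msize (mnode cs) = suc (msizes cs)

  msizes : List (ℕ × MTree) → ℕ
  msizes [] = 0
  msizes ((_ , t) ∷ cs) = msize t + msizes cs

mutual
  mheight : MTree → ℕ
  mheight (mnode []) = 0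
  mheight (mnode (c ∷ cs)) = suc (mheights (c ∷ cs))

  mheights : List (ℕ × MTree) → ℕ
  mheights [] = 0
  mheights ((_ , t) ∷ cs) = mheight t ⊔ mheights cs

mutual
  isDAryM : ℕ → MTree → Bool
  isDAryM d t@(mnode cs) = (outdeg t ≤ᵇ d) ∧ allDAryM d cs

  allDAryM : ℕ → List (ℕ × MTree) → Bool
  allDAryM d [] = true
  allDAryM d ((_ , t) ∷ cs) = isDAryM d t ∧ allDAryM d cs

data DTree (d : ℕ) : Set where
  dnode : Vec (Maybe (DTree d)) d → DTree d

mutual
  dsize : ∀ {d} → DTree d → ℕ
  dsize (dnode cs) = suc (dsizes cs)

  dsizes : ∀ {d m} → Vec (Maybe (DTree d)) m → ℕ
  dsizes [] = 0
  dsizes (nothing ∷ cs) = dsizes cs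
  dsizes (just t ∷ cs) = dsize t + dsizes cs

mutual
  dheight : ∀ {d} → DTree d → ℕ
  dheight (dnode cs) = dheights cs

  dheights : ∀ {d m} → Vec (Maybe (DTree d)) m → ℕ
  dheights [] = 0
  dheights (nothing ∷ cs) = dheights cs
  dheights (just t ∷ cs) = suc (dheight t) ⊔ dheights cs

open import Relation.Binary.PropositionalEquality using (_≡_)
open import Data.Product using (Σ)

MultiEdgeTrees : ℕ → ℕ → ℕ → Set
MultiEdgeTrees d h n =
  Σ MTree λ t → (isDAryM d t ≡ true) × (mheight t ≡ h) × (msize t ≡ n)

DAryTrees : ℕ → ℕ → ℕ → Set
DAryTrees d h n = Σ (DTree d) λ t → (dheight t ≡ h) × (dsize t ≡ n)

-- Read the d child slots of a vertex of a d-ary tree from left to right: a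
-- child preceded by k empty slots becomes a child joined by k + 1 parallel
-- edges, and trailing empty slots are dropped. Conversely a multi-edge
-- child of multiplicity k + 1 is written as k empty slots followed by the
-- child, which fits into d slots exactly when the out-degree is at most d.
-- The vertices and the parent relation are untouched, so size and height
-- are preserved.
module Submission where

open import Defs
open import Data.Nat using (ℕ; _≥_)
open import Function.Bundles using (_↔_)

open import Data.Nat using (zero; suc; _+_; _⊔_; _≤ᵇ_; _≤_; s≤s; z≤n)
open import Data.Nat.Properties using (≤ᵇ⇒≤; ≤⇒≤ᵇ; ≤-refl; ≤-trans; ⊔-identityʳ)
import Data.Nat.Properties as ℕ
open import Data.Bool using (Bool; true; _∧_)
open import Data.Bool.Properties using (∧-conicalˡ; ∧-conicalʳ; T-≡)
import Data.Bool.Properties as Bool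
open import Data.List using (List; []; _∷_)
open import Data.Vec using (Vec; []; _∷_)
open import Data.Maybe using (Maybe; just; nothing)
open import Data.Product using (Σ; _×_; _,_)
open import Function.Bundles using (mk↔ₛ′; Equivalence)
open import Relation.Nullary.Irrelevant using (Irrelevant)
open import Relation.Binary.PropositionalEquality
  using (_≡_; refl; sym; trans; cong; cong₂; subst)
open import Axiom.UniquenessOfIdentityProofs using (module Decidable⇒UIP)
open import Level using (Level)

Σ-≡-irrelevant : ∀ {a p} {A : Set a} {P : A → Set p} → (∀ {x} → Irrelevant (P x)) →
                 ∀ {x y} {px : P x} {py : P y} → x ≡ y → (x , px) ≡ (y , py)
Σ-≡-irrelevant P-irr {px = px} {py} refl = cong (_ ,_) (P-irr px py)

module _ {a b p q : Level} {A : Set a} {B : Set b} {P : A → Set p} {Q : B → Set q} where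

  Σ-↔ : (f : A → B) (g : B → A) →
        (∀ y → f (g y) ≡ y) → (∀ {x} → P x → g (f x) ≡ x) →
        (∀ {y} → Q y → P (g y)) → (∀ {y} → P (g y) → Q y) →
        (∀ {x} → Irrelevant (P x)) → (∀ {y} → Irrelevant (Q y)) →
        Σ A P ↔ Σ B Q
  Σ-↔ f g f∘g g∘f Q⇒P P⇒Q P-irr Q-irr = mk↔ₛ′ to from to∘from from∘to
    where
    to : Σ A P → Σ B Q
    to (x , px) = f x , P⇒Q (subst P (sym (g∘f px)) px)

    from : Σ B Q → Σ A P
    from (y , qy) = g y , Q⇒P qy

    to∘from : ∀ z → to (from z) ≡ z
    to∘from (y , _) = Σ-≡-irrelevant Q-irr (f∘g y)

    from∘to : ∀ z → from (to z) ≡ z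
    from∘to (x , px) = Σ-≡-irrelevant P-irr (g∘f px)

×-irrelevant : ∀ {a b} {A : Set a} {B : Set b} →
               Irrelevant A → Irrelevant B → Irrelevant (A × B)
×-irrelevant A-irr B-irr (x , y) (x′ , y′) = cong₂ _,_ (A-irr x x′) (B-irr y y′)

≤ᵇ≡true⇒≤ : ∀ m n → (m ≤ᵇ n) ≡ true → m ≤ n
≤ᵇ≡true⇒≤ m n eq = ≤ᵇ⇒≤ m n (Equivalence.from T-≡ eq)

≤⇒≤ᵇ≡true : ∀ {m n} → m ≤ n → (m ≤ᵇ n) ≡ true
≤⇒≤ᵇ≡true m≤n = Equivalence.to T-≡ (≤⇒≤ᵇ m≤n)

addEdge : List (ℕ × MTree) → List (ℕ × MTree)
addEdge [] = []
addEdge ((k , t) ∷ cs) = (suc k , t) ∷ cs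

outdeg-addEdge : ∀ cs → outdeg (mnode (addEdge cs)) ≤ suc (outdeg (mnode cs))
outdeg-addEdge [] = z≤n
outdeg-addEdge (_ ∷ _) = ≤-refl

allDAryM-addEdge : ∀ d cs → allDAryM d (addEdge cs) ≡ allDAryM d cs
allDAryM-addEdge d [] = refl
allDAryM-addEdge d (_ ∷ _) = refl

msizes-addEdge : ∀ cs → msizes (addEdge cs) ≡ msizes cs
msizes-addEdge [] = refl
msizes-addEdge (_ ∷ _) = refl

mheight-addEdge : ∀ cs → mheight (mnode (addEdge cs)) ≡ mheight (mnode cs)
mheight-addEdge [] = refl
mheight-addEdge (_ ∷ _) = refl

mheight-∷ : ∀ k t cs → mheight (mnode ((k , t) ∷ cs)) ≡ suc (mheight t) ⊔ mheight (mnode cs)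
mheight-∷ k t [] = cong suc (⊔-identityʳ (mheight t))
mheight-∷ k t (_ ∷ _) = refl

module _ (d : ℕ) where

  mutual
    toDTree : MTree → DTree d
    toDTree (mnode cs) = dnode (encodeChildren d cs)

    -- Fills m slots; children that do not fit are cut off.
    encodeChildren : (m : ℕ) → List (ℕ × MTree) → Vec (Maybe (DTree d)) m
    encodeChildren zero _ = []
    encodeChildren (suc m) [] = nothing ∷ encodeChildren m []
    encodeChildren (suc m) ((k , t) ∷ cs) = encodeChild m k t cs

    encodeChild : (m : ℕ) → ℕ → MTree → List (ℕ × MTree) → Vec (Maybe (DTree d)) (suc m)
    encodeChild m zero t cs = just (toDTree t) ∷ encodeChildren m cs
    encodeChild zero (suc k) t cs = nothing ∷ []
    encodeChild (suc m) (suc k) t cs = nothing ∷ encodeChild m k t cs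

  mutual
    toMTree : DTree d → MTree
    toMTree (dnode v) = mnode (decodeChildren v)

    decodeChildren : ∀ {m} → Vec (Maybe (DTree d)) m → List (ℕ × MTree)
    decodeChildren [] = []
    decodeChildren (just t ∷ v) = (0 , toMTree t) ∷ decodeChildren v
    decodeChildren (nothing ∷ v) = addEdge (decodeChildren v)

  encodeChildren-addEdge : ∀ m cs →
    encodeChildren (suc (suc m)) (addEdge cs) ≡ nothing ∷ encodeChildren (suc m) cs
  encodeChildren-addEdge m [] = refl
  encodeChildren-addEdge m (_ ∷ _) = refl

  mutual
    toDTree∘toMTree : ∀ t → toDTree (toMTree t) ≡ t
    toDTree∘toMTree (dnode v) = cong dnode (encode∘decode v)

    encode∘decode : ∀ {m} (v : Vec (Maybe (DTree d)) m) → encodeChildren m (decodeChildren v) ≡ v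
    encode∘decode [] = refl
    encode∘decode (just t ∷ v) = cong₂ _∷_ (cong just (toDTree∘toMTree t)) (encode∘decode v)
    encode∘decode {suc zero} (nothing ∷ []) = refl
    encode∘decode {suc (suc m)} (nothing ∷ v) =
      trans (encodeChildren-addEdge m (decodeChildren v)) (cong (nothing ∷_) (encode∘decode v))

  mutual
    toMTree∘toDTree : ∀ t → isDAryM d t ≡ true → toMTree (toDTree t) ≡ t
    toMTree∘toDTree t@(mnode cs) ok = cong mnode (decode∘encode d cs outdeg≤d (∧-conicalʳ _ _ ok))
      where
      outdeg≤d : outdeg t ≤ d
      outdeg≤d = ≤ᵇ≡true⇒≤ (outdeg t) d (∧-conicalˡ _ _ ok)

    decode∘encode : ∀ m cs → outdeg (mnode cs) ≤ m → allDAryM d cs ≡ true →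
                    decodeChildren (encodeChildren m cs) ≡ cs
    decode∘encode zero [] _ _ = refl
    decode∘encode (suc m) [] _ ok = cong addEdge (decode∘encode m [] z≤n ok)
    decode∘encode (suc m) ((k , t) ∷ cs) deg≤m ok = decode∘encodeChild m k t cs deg≤m ok

    decode∘encodeChild : ∀ m k t cs → suc k + outdeg (mnode cs) ≤ suc m →
                         allDAryM d ((k , t) ∷ cs) ≡ true →
                         decodeChildren (encodeChild m k t cs) ≡ (k , t) ∷ cs
    decode∘encodeChild m zero t cs (s≤s deg≤m) ok =
      cong₂ (λ t′ cs′ → (0 , t′) ∷ cs′)
        (toMTree∘toDTree t (∧-conicalˡ _ _ ok))
        (decode∘encode m cs deg≤m (∧-conicalʳ _ _ ok))
    decode∘encodeChild (suc m) (suc k) t cs (s≤s deg≤m) ok =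
      cong addEdge (decode∘encodeChild m k t cs deg≤m ok)

  mutual
    isDAryM-toMTree : ∀ t → isDAryM d (toMTree t) ≡ true
    isDAryM-toMTree (dnode v) =
      cong₂ _∧_ (≤⇒≤ᵇ≡true (outdeg-decodeChildren v)) (allDAryM-decodeChildren v)

    outdeg-decodeChildren : ∀ {m} (v : Vec (Maybe (DTree d)) m) → outdeg (mnode (decodeChildren v)) ≤ m
    outdeg-decodeChildren [] = z≤n
    outdeg-decodeChildren (just t ∷ v) = s≤s (outdeg-decodeChildren v)
    outdeg-decodeChildren (nothing ∷ v) =
      ≤-trans (outdeg-addEdge (decodeChildren v)) (s≤s (outdeg-decodeChildren v))

    allDAryM-decodeChildren : ∀ {m} (v : Vec (Maybe (DTree d)) m) → allDAryM d (decodeChildren v) ≡ true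
    allDAryM-decodeChildren [] = refl
    allDAryM-decodeChildren (just t ∷ v) = cong₂ _∧_ (isDAryM-toMTree t) (allDAryM-decodeChildren v)
    allDAryM-decodeChildren (nothing ∷ v) =
      trans (allDAryM-addEdge d (decodeChildren v)) (allDAryM-decodeChildren v)

  mutual
    msize-toMTree : ∀ t → msize (toMTree t) ≡ dsize t
    msize-toMTree (dnode v) = cong suc (msizes-decodeChildren v)

    msizes-decodeChildren : ∀ {m} (v : Vec (Maybe (DTree d)) m) → msizes (decodeChildren v) ≡ dsizes v
    msizes-decodeChildren [] = refl
    msizes-decodeChildren (just t ∷ v) = cong₂ _+_ (msize-toMTree t) (msizes-decodeChildren v)
    msizes-decodeChildren (nothing ∷ v) =
      trans (msizes-addEdge (decodeChildren v)) (msizes-decodeChildren v)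

  mutual
    mheight-toMTree : ∀ t → mheight (toMTree t) ≡ dheight t
    mheight-toMTree (dnode v) = mheight-decodeChildren v

    mheight-decodeChildren : ∀ {m} (v : Vec (Maybe (DTree d)) m) →
                             mheight (mnode (decodeChildren v)) ≡ dheights v
    mheight-decodeChildren [] = refl
    mheight-decodeChildren (just t ∷ v) =
      trans (mheight-∷ 0 (toMTree t) (decodeChildren v))
            (cong₂ (λ h h′ → suc h ⊔ h′) (mheight-toMTree t) (mheight-decodeChildren v))
    mheight-decodeChildren (nothing ∷ v) =
      trans (mheight-addEdge (decodeChildren v)) (mheight-decodeChildren v)

corollary2p2 : (d n h : ℕ) → d ≥ 1 → n ≥ 1 →
    MultiEdgeTrees d h n ↔ DAryTrees d h n
corollary2p2 d n h _ _ =
  Σ-↔ (toDTree d) (toMTree d) (toDTree∘toMTree d)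
      (λ {t} (ok , _) → toMTree∘toDTree d t ok)
      from-shape to-shape
      (×-irrelevant Bool-≡-irrelevant (×-irrelevant ℕ.≡-irrelevant ℕ.≡-irrelevant))
      (×-irrelevant ℕ.≡-irrelevant ℕ.≡-irrelevant)
  where
  Bool-≡-irrelevant : ∀ {x y : Bool} → Irrelevant (x ≡ y)
  Bool-≡-irrelevant = Decidable⇒UIP.≡-irrelevant Bool._≟_

  from-shape : ∀ {t} → dheight t ≡ h × dsize t ≡ n →
               isDAryM d (toMTree d t) ≡ true × mheight (toMTree d t) ≡ h × msize (toMTree d t) ≡ n
  from-shape {t} (h≡ , n≡) =
    isDAryM-toMTree d t , trans (mheight-toMTree d t) h≡ , trans (msize-toMTree d t) n≡

  to-shape : ∀ {t} → isDAryM d (toMTree d t) ≡ true × mheight (toMTree d t) ≡ h × msize (toMTree d t) ≡ n →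
             dheight t ≡ h × dsize t ≡ n
  to-shape {t} (_ , h≡ , n≡) = trans (sym (mheight-toMTree d t)) h≡ , trans (sym (msize-toMTree d t)) n≡
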